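{- (a) $\mathit{Num}(\ast)$ is solved exactly by the $0$-numerals, i.e. for a term $a$ without unknowns, $\models\mathit{Num}(a)$ iff $a=S^m(0)$ for some $m\ge0$. (b) For all natural numbers $m,p,q$: $\mathit{Add}(S^m(0),S^p(0),S^q(0),\ast)$ is solvable iff $m+p=q$. (c) For all natural numbers $m,p,q$: $\mathit{Mul}(S^m(0),S^p(0),S^q(0),\ast,\ast_1)$ is solvable iff $m\cdot p=q$.
   Context: First-order predicate calculus with identity $\doteq$, over a language with countably many variables and countably infinitely many function and predicate symbols of every arity; terms are variable-free; $\models\theta$ means $\theta$ is true in every structure. An infinite set of distinguished constants, called unknowns, is singled out; $\ast,\ast_1$ denote distinct unknowns. A quantifier-free formula $\phi(\bar\ast)$ (unknowns among $\bar\ast$) is solvable if there are terms $\bar a$ without unknowns with $\models\phi(\bar a)$; such $\bar a$ solve it. $S^0(t)=t$, $S^{m+1}(t)=S(S^m(t))$; terms $S^m(0)$ are $0$-numerals. The language contains distinct constants $0,\hat 0,\tilde 0,k,\tilde k$ (not unknowns), a unary function symbol $S$ and a binary function symbol $\mathrm{pr}$. Define: $\mathit{Num}(x)$: $0\doteq S(0)\to 0\doteq x$; $\widetilde{\mathit{Num}}(x)$: $\tilde0\doteq S(\tilde0)\to\tilde0\doteq x$; $\mathit{Sim}(x,y)$: $0\doteq\tilde0\to x\doteq y$; $\mathit{Plus}(x,y,z)$: $\tilde0\doteq x\to z\doteq y$; $\mathit{Add}(x,y,z,w)$: $\widetilde{\mathit{Num}}(w)\wedge\mathit{Sim}(y,w)\wedge\mathit{Plus}(x,w,z)$;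 $\mathit{Tab}(x)$: $0\doteq S(0)\wedge k\doteq\mathrm{pr}(\mathrm{pr}(0,0),k)\to k\doteq x$; $\widetilde{\mathit{Tab}}(x)$: $\hat0\doteq S(\hat0)\wedge\tilde0\doteq S(\tilde0)\wedge\tilde k\doteq\mathrm{pr}(\mathrm{pr}(\hat0,\tilde0),\tilde k)\to\tilde k\doteq x$; $\widetilde{\mathit{Sim}}(x,y)$: $0\doteq\hat0\wedge0\doteq\tilde0\wedge k\doteq\tilde k\to x\doteq y$; $\mathit{Tim}(x,y,z,w,\tilde w)$: $\hat0\doteq S(0)\wedge\tilde0\doteq x\wedge\tilde k\doteq\mathrm{pr}(\mathrm{pr}(0,0),k)\to\tilde w\doteq\mathrm{pr}(\mathrm{pr}(y,z),w)$; $\mathit{Mul}(x,y,z,w,\tilde w)$: $\mathit{Tab}(w)\wedge\widetilde{\mathit{Tab}}(\tilde w)\wedge\widetilde{\mathit{Sim}}(w,\tilde w)\wedge\mathit{Tim}(x,y,z,w,\tilde w)$. -}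

module Defs where

open import Data.Nat using (ℕ; zero; suc)
open import Data.Vec using (Vec; []; _∷_)
open import Data.Product using (_×_; _,_; Σ)
open import Data.Sum using (_⊎_)
open import Data.Empty using (⊥)
open import Data.Unit using (⊤)
open import Relation.Binary.PropositionalEquality using (_≡_)

data FSym : ℕ → Set where
  c0     : FSym 0
  ĉ0     : FSym 0
  c̃0     : FSym 0
  ck     : FSym 0
  c̃k     : FSym 0
  fS     : FSym 1
  fpr    : FSym 2
  unk    : ℕ → FSym 0
  fsym   : (n i : ℕ) → FSym n

data PSym : ℕ → Set where
  psym : (n i : ℕ) → PSym n

data Term : Set where
  app : ∀ {n} → FSym n → Vec Term n → Term

infix  7 _≐_
infixr 6 _∧_
infixr 5 _∨_
infixr 4 _⇒_
data Formula : Set where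
  _≐_  : Term → Term → Formula
  rel  : ∀ {n} → PSym n → Vec Term n → Formula
  ⊤f ⊥f : Formula
  ¬f   : Formula → Formula
  _∧_  : Formula → Formula → Formula
  _∨_  : Formula → Formula → Formula
  _⇒_  : Formula → Formula → Formula

record Structure : Set₁ where
  field
    Carrier : Set
    funI    : ∀ {n} → FSym n → Vec Carrier n → Carrier
    relI    : ∀ {n} → PSym n → Vec Carrier n → Set

module _ (M : Structure) where
  open Structure M

  mutual
    eval : Term → Carrier
    eval (app f ts) = funI f (evalVec ts)

    evalVec : ∀ {n} → Vec Term n → Vec Carrier n
    evalVec []       = []
    evalVec (t ∷ ts) = eval t ∷ evalVec ts

  Sat : Formula → Set
  Sat (t ≐ u)   = eval t ≡ eval u
  Sat (rel P ts) = relI P (evalVec ts)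
  Sat ⊤f        = ⊤
  Sat ⊥f        = ⊥
  Sat (¬f φ)    = Sat φ → ⊥
  Sat (φ ∧ ψ)   = Sat φ × Sat ψ
  Sat (φ ∨ ψ)   = Sat φ ⊎ Sat ψ
  Sat (φ ⇒ ψ)   = Sat φ → Sat ψ

⊨_ : Formula → Set₁
⊨ θ = (M : Structure) → Sat M θ

mutual
  NoUnk : Term → Set
  NoUnk (app (unk i) ts) = ⊥
  NoUnk (app c0 ts)  = NoUnkVec ts
  NoUnk (app ĉ0 ts)  = NoUnkVec ts
  NoUnk (app c̃0 ts)  = NoUnkVec ts
  NoUnk (app ck ts)  = NoUnkVec ts
  NoUnk (app c̃k ts)  = NoUnkVec ts
  NoUnk (app fS ts)  = NoUnkVec ts
  NoUnk (app fpr ts) = NoUnkVec ts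
  NoUnk (app (fsym n i) ts) = NoUnkVec ts

  NoUnkVec : ∀ {n} → Vec Term n → Set
  NoUnkVec []       = ⊤
  NoUnkVec (t ∷ ts) = NoUnk t × NoUnkVec ts

`0 `0̂ `0̃ `k `k̃ : Term
`0 = app c0 []
`0̂ = app ĉ0 []
`0̃ = app c̃0 []
`k = app ck []
`k̃ = app c̃k []

S : Term → Term
S t = app fS (t ∷ [])

pr : Term → Term → Term
pr t u = app fpr (t ∷ u ∷ [])

S^ : ℕ → Term → Term
S^ zero    t = t
S^ (suc m) t = S (S^ m t)

num : ℕ → Term
num m = S^ m `0

-- The formulas of the paper (formulas with unknowns among x̄ are
-- represented as functions of the terms substituted for the unknowns).

Num : Term → Formula
Num x = `0 ≐ S `0 ⇒ `0 ≐ x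

Num~ : Term → Formula
Num~ x = `0̃ ≐ S `0̃ ⇒ `0̃ ≐ x

Sim : Term → Term → Formula
Sim x y = `0 ≐ `0̃ ⇒ x ≐ y

Plus : Term → Term → Term → Formula
Plus x y z = `0̃ ≐ x ⇒ z ≐ y

Add : Term → Term → Term → Term → Formula
Add x y z w = Num~ w ∧ Sim y w ∧ Plus x w z

Tab : Term → Formula
Tab x = (`0 ≐ S `0 ∧ `k ≐ pr (pr `0 `0) `k) ⇒ `k ≐ x

Tab~ : Term → Formula
Tab~ x = (`0̂ ≐ S `0̂ ∧ `0̃ ≐ S `0̃ ∧ `k̃ ≐ pr (pr `0̂ `0̃) `k̃) ⇒ `k̃ ≐ x

Sim~ : Term → Term → Formula
Sim~ x y = (`0 ≐ `0̂ ∧ `0 ≐ `0̃ ∧ `k ≐ `k̃) ⇒ x ≐ y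

Tim : Term → Term → Term → Term → Term → Formula
Tim x y z w w~ = (`0̂ ≐ S `0 ∧ `0̃ ≐ x ∧ `k̃ ≐ pr (pr `0 `0) `k) ⇒ w~ ≐ pr (pr y z) w

Mul : Term → Term → Term → Term → Term → Formula
Mul x y z w w~ = Tab w ∧ Tab~ w~ ∧ Sim~ w w~ ∧ Tim x y z w w~

Solvable₁ : (Term → Formula) → Set₁
Solvable₁ φ = Σ Term λ a → NoUnk a × (⊨ φ a)

Solvable₂ : (Term → Term → Formula) → Set₁
Solvable₂ φ = Σ Term λ a → Σ Term λ b → NoUnk a × NoUnk b × (⊨ φ a b)

module Submission where

-- Every "if" direction exhibits a witness and checks it with equational
-- reasoning valid in all structures: S^m(c) collapses to c when c ≐ S(c),
-- and a table  pr(pr(S^a c₁, S^b c₂), … e)  collapses to e when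
-- e ≐ pr(pr(c₁, c₂), e) (Tab), is congruent in c₁, c₂, e (Sim~), and the
-- multiplication table satisfies Tim.
--
-- Every "only if" direction evaluates the formula in two kinds of
-- structures.  The recogniser structures satisfy the hypotheses of Num,
-- Num~, Tab and Tab~, and evaluate a term to the grammatical category it
-- belongs to, so the unknown must be a numeral or a table (for this the
-- constants get a decidable equality).  The value structures interpret S
-- as successor and pr as list building, so that Sim, Plus, Sim~ and Tim
-- turn into equations between natural numbers and lists of pairs, from
-- which m + p ≡ q and m * p ≡ q follow.

open import Defs
open import Data.Nat using (ℕ; zero; suc; _+_; _*_; _≟_)
open import Data.Nat.Properties using (+-identityʳ; +-comm; *-comm)
open import Data.Bool using (Bool; false; T) renaming (_∧_ to _and_)
open import Data.Bool.Properties using (T-∧)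
open import Data.Product using (_×_; Σ; _,_; proj₁; proj₂)
open import Data.Product.Properties using (≡-dec)
open import Data.List using (List; []; _∷_; map; _++_)
open import Data.List.Properties using (map-id; map-cong; ++-identityʳ; ∷-injective)
open import Data.Unit using (⊤; tt)
open import Data.Vec using (Vec; []; _∷_)
open import Function using (_∘_)
open import Function.Bundles using (_⇔_; mk⇔; mk↣; Equivalence)
open import Relation.Binary.Definitions using (DecidableEquality)
open import Relation.Nullary.Decidable using (isYes; via-injection; toWitness; fromWitness)
open import Relation.Binary.PropositionalEquality
  using (_≡_; refl; sym; trans; cong; cong₂; subst; module ≡-Reasoning)

open ≡-Reasoning

atom : FSym 0 → Term
atom c = app c []

S^-+ : ∀ a b t → S^ a (S^ b t) ≡ S^ (a + b) t
S^-+ zero    b t = refl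
S^-+ (suc a) b t = cong S (S^-+ a b t)

-- The row  pr(S^a c₁, S^b c₂)  and the table listing rows in front of e;
-- Tab, Tab~ have such tables as solutions.
row : Term → Term → ℕ × ℕ → Term
row c₁ c₂ (a , b) = pr (S^ a c₁) (S^ b c₂)

table : Term → Term → Term → List (ℕ × ℕ) → Term
table c₁ c₂ e []      = e
table c₁ c₂ e (r ∷ l) = pr (row c₁ c₂ r) (table c₁ c₂ e l)

products : ℕ → ℕ → List (ℕ × ℕ)
products m zero    = []
products m (suc n) = (n , n * m) ∷ products m n

noUnk-S^ : ∀ a {t} → NoUnk t → NoUnk (S^ a t)
noUnk-S^ zero    h = h
noUnk-S^ (suc a) h = noUnk-S^ a h , tt

noUnk-table : ∀ {c₁ c₂ e} → NoUnk c₁ → NoUnk c₂ → NoUnk e → ∀ l → NoUnk (table c₁ c₂ e l)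
noUnk-table h₁ h₂ h []            = h
noUnk-table h₁ h₂ h ((a , b) ∷ l) =
  (noUnk-S^ a h₁ , noUnk-S^ b h₂ , tt) , noUnk-table h₁ h₂ h l , tt

_≟ᶜ_ : DecidableEquality (FSym 0)
_≟ᶜ_ = via-injection (mk↣ code-injective) (≡-dec _≟_ _≟_)
  where
    code : FSym 0 → ℕ × ℕ
    code c0         = 0 , 0
    code ĉ0         = 1 , 0
    code c̃0         = 2 , 0
    code ck         = 3 , 0
    code c̃k         = 4 , 0
    code (unk i)    = 5 , i
    code (fsym _ i) = 6 , i

    decode : ℕ × ℕ → FSym 0
    decode (1 , _) = ĉ0
    decode (2 , _) = c̃0
    decode (3 , _) = ck
    decode (4 , _) = c̃k
    decode (5 , i) = unk i
    decode (6 , i) = fsym 0 i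
    decode _       = c0

    decode-code : ∀ c → decode (code c) ≡ c
    decode-code c0         = refl
    decode-code ĉ0         = refl
    decode-code c̃0         = refl
    decode-code ck         = refl
    decode-code c̃k         = refl
    decode-code (unk i)    = refl
    decode-code (fsym _ i) = refl

    code-injective : ∀ {c d} → code c ≡ code d → c ≡ d
    code-injective {c} {d} eq =
      trans (sym (decode-code c)) (trans (cong decode eq) (decode-code d))

module Equational (M : Structure) where
  open Structure M

  ⟦_⟧ : Term → Carrier
  ⟦_⟧ = eval M

  S-cong : ∀ {x y} → x ≡ y → funI fS (x ∷ []) ≡ funI fS (y ∷ [])
  S-cong = cong (λ x → funI fS (x ∷ []))

  pr-cong : ∀ {x x′ y y′} → x ≡ x′ → y ≡ y′ → funI fpr (x ∷ y ∷ []) ≡ funI fpr (x′ ∷ y′ ∷ [])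
  pr-cong = cong₂ (λ x y → funI fpr (x ∷ y ∷ []))

  S^-cong : ∀ a t u → ⟦ t ⟧ ≡ ⟦ u ⟧ → ⟦ S^ a t ⟧ ≡ ⟦ S^ a u ⟧
  S^-cong zero    t u h = h
  S^-cong (suc a) t u h = S-cong (S^-cong a t u h)

  S^-fixed : ∀ t → ⟦ t ⟧ ≡ ⟦ S t ⟧ → ∀ a → ⟦ S^ a t ⟧ ≡ ⟦ t ⟧
  S^-fixed t h zero    = refl
  S^-fixed t h (suc a) = trans (S-cong (S^-fixed t h a)) (sym h)

  table-cong : ∀ c₁ c₂ e d₁ d₂ e′ → ⟦ c₁ ⟧ ≡ ⟦ d₁ ⟧ → ⟦ c₂ ⟧ ≡ ⟦ d₂ ⟧ → ⟦ e ⟧ ≡ ⟦ e′ ⟧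
             → ∀ l → ⟦ table c₁ c₂ e l ⟧ ≡ ⟦ table d₁ d₂ e′ l ⟧
  table-cong c₁ c₂ e d₁ d₂ e′ h₁ h₂ h []            = h
  table-cong c₁ c₂ e d₁ d₂ e′ h₁ h₂ h ((a , b) ∷ l) =
    pr-cong (pr-cong (S^-cong a c₁ d₁ h₁) (S^-cong b c₂ d₂ h₂))
            (table-cong c₁ c₂ e d₁ d₂ e′ h₁ h₂ h l)

  table-absorbed : ∀ c₁ c₂ e → ⟦ c₁ ⟧ ≡ ⟦ S c₁ ⟧ → ⟦ c₂ ⟧ ≡ ⟦ S c₂ ⟧
                 → ⟦ e ⟧ ≡ ⟦ pr (pr c₁ c₂) e ⟧ → ∀ l → ⟦ e ⟧ ≡ ⟦ table c₁ c₂ e l ⟧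
  table-absorbed c₁ c₂ e h₁ h₂ h []            = refl
  table-absorbed c₁ c₂ e h₁ h₂ h ((a , b) ∷ l) =
    trans h (pr-cong (pr-cong (sym (S^-fixed c₁ h₁ a)) (sym (S^-fixed c₂ h₂ b)))
                     (table-absorbed c₁ c₂ e h₁ h₂ h l))

  table-multiplication : ∀ c₁ c₂ e d e₀ m → ⟦ c₁ ⟧ ≡ ⟦ S d ⟧ → ⟦ c₂ ⟧ ≡ ⟦ S^ m d ⟧
                       → ⟦ e ⟧ ≡ ⟦ pr (pr d d) e₀ ⟧ → ∀ n
                       → ⟦ table c₁ c₂ e (products m n) ⟧
                         ≡ ⟦ pr (pr (S^ n d) (S^ (n * m) d)) (table d d e₀ (products m n)) ⟧
  table-multiplication c₁ c₂ e d e₀ m h₁ h₂ h zero    = h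
  table-multiplication c₁ c₂ e d e₀ m h₁ h₂ h (suc n) =
    pr-cong (pr-cong first second) (table-multiplication c₁ c₂ e d e₀ m h₁ h₂ h n)
    where
      first : ⟦ S^ n c₁ ⟧ ≡ ⟦ S^ (suc n) d ⟧
      first = trans (S^-cong n c₁ (S d) h₁)
                    (cong ⟦_⟧ (trans (S^-+ n 1 d) (cong (λ k → S^ k d) (+-comm n 1))))
      second : ⟦ S^ (n * m) c₂ ⟧ ≡ ⟦ S^ (suc n * m) d ⟧
      second = trans (S^-cong (n * m) c₂ (S^ m d) h₂)
                     (cong ⟦_⟧ (trans (S^-+ (n * m) m d) (cong (λ k → S^ k d) (+-comm (n * m) m))))

-- Recognisers: structures whose value of a term is its grammatical
-- category (numeral over c₁, numeral over c₂, row, table)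

data Column : Set where
  left right : Column

-- Membership of a term in each category; a constant equal to both c₁
-- and c₂ (as in Tab) is a numeral in both columns.
record Category : Set where
  constructor category
  field
    numeral₁ numeral₂ isRow isTable : Bool
open Category

numeral : Column → Category → Bool
numeral left  = numeral₁
numeral right = numeral₂

module Recogniser (c₁ c₂ e : FSym 0) where

  base : Column → FSym 0
  base left  = c₁
  base right = c₂

  categoryOf : FSym 0 → Category
  categoryOf c = category (isYes (c ≟ᶜ c₁)) (isYes (c ≟ᶜ c₂)) false (isYes (c ≟ᶜ e))

  successor : Category → Category
  successor x = category (numeral₁ x) (numeral₂ x) false false

  pairing : Category → Category → Category
  pairing x y = category false false (numeral₁ x and numeral₂ y) (isRow x and isTable y)

  interpret : ∀ {n} → FSym n → Vec Category n → Category
  interpret {zero} c []      = categoryOf c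
  interpret fS (x ∷ [])      = successor x
  interpret fpr (x ∷ y ∷ []) = pairing x y
  interpret _ _              = category false false false false

  recogniser : Structure
  recogniser = record { Carrier = Category ; funI = interpret ; relI = λ _ _ → ⊤ }

  ⟦_⟧ : Term → Category
  ⟦_⟧ = eval recogniser

  numeral-sound : ∀ col t → T (numeral col ⟦ t ⟧) → Σ ℕ λ a → t ≡ S^ a (atom (base col))
  numeral-sound left  (app {zero} c []) h = 0 , cong atom (toWitness {a? = c ≟ᶜ c₁} h)
  numeral-sound right (app {zero} c []) h = 0 , cong atom (toWitness {a? = c ≟ᶜ c₂} h)
  numeral-sound left  (app fS (t ∷ [])) h with numeral-sound left t h
  ... | a , refl = suc a , refl
  numeral-sound right (app fS (t ∷ [])) h with numeral-sound right t h
  ... | a , refl = suc a , refl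
  numeral-sound left  (app fpr (t ∷ u ∷ [])) ()
  numeral-sound right (app fpr (t ∷ u ∷ [])) ()
  numeral-sound left  (app (fsym (suc n) i) (t ∷ ts)) ()
  numeral-sound right (app (fsym (suc n) i) (t ∷ ts)) ()

  row-sound : ∀ t → T (isRow ⟦ t ⟧) → Σ (ℕ × ℕ) λ r → t ≡ row (atom c₁) (atom c₂) r
  row-sound (app fpr (t ∷ u ∷ [])) h
    with numeral-sound left t (proj₁ (Equivalence.to T-∧ h))
       | numeral-sound right u (proj₂ (Equivalence.to T-∧ h))
  ... | a , refl | b , refl = (a , b) , refl
  row-sound (app {zero} c []) ()
  row-sound (app fS (t ∷ [])) ()
  row-sound (app (fsym (suc n) i) (t ∷ ts)) ()

  table-sound : ∀ t → T (isTable ⟦ t ⟧) → Σ (List (ℕ × ℕ)) λ l → t ≡ table (atom c₁) (atom c₂) (atom e) l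
  table-sound (app {zero} c []) h = [] , cong atom (toWitness {a? = c ≟ᶜ e} h)
  table-sound (app fpr (t ∷ u ∷ [])) h
    with row-sound t (proj₁ (Equivalence.to T-∧ h)) | table-sound u (proj₂ (Equivalence.to T-∧ h))
  ... | r , refl | l , refl = r ∷ l , refl
  table-sound (app fS (t ∷ [])) ()
  table-sound (app (fsym (suc n) i) (t ∷ ts)) ()

  numeral-of-value : ∀ col t → ⟦ t ⟧ ≡ ⟦ atom (base col) ⟧ → Σ ℕ λ a → t ≡ S^ a (atom (base col))
  numeral-of-value col t h = numeral-sound col t (subst (T ∘ numeral col) (sym h) (base-numeral col))
    where
      base-numeral : ∀ col → T (numeral col ⟦ atom (base col) ⟧)
      base-numeral left  = fromWitness {a? = c₁ ≟ᶜ c₁} refl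
      base-numeral right = fromWitness {a? = c₂ ≟ᶜ c₂} refl

  table-of-value : ∀ t → ⟦ t ⟧ ≡ ⟦ atom e ⟧ → Σ (List (ℕ × ℕ)) λ l → t ≡ table (atom c₁) (atom c₂) (atom e) l
  table-of-value t h = table-sound t (subst (T ∘ isTable) (sym h) (fromWitness {a? = e ≟ᶜ e} refl))

-- Value structures: S is the successor on numbers and pr builds lists of
-- pairs of numbers; ill-formed applications get the arbitrary value 0.

data Value : Set where
  number  : ℕ → Value
  entry   : ℕ → ℕ → Value
  entries : List (ℕ × ℕ) → Value

number-injective : ∀ {a b} → number a ≡ number b → a ≡ b
number-injective refl = refl

entries-injective : ∀ {l l′} → entries l ≡ entries l′ → l ≡ l′
entries-injective refl = refl

-- The row (a, b) of a table whose numeral bases have values z₁ and z₂.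
shift : ℕ → ℕ → ℕ × ℕ → ℕ × ℕ
shift z₁ z₂ (a , b) = a + z₁ , b + z₂

shift-zero : ∀ l → map (shift 0 0) l ≡ l
shift-zero l = trans (map-cong (λ (a , b) → cong₂ _,_ (+-identityʳ a) (+-identityʳ b)) l) (map-id l)

module Values (ρ : FSym 0 → Value) where

  successor : Value → Value
  successor (number n) = number (suc n)
  successor _          = number 0

  pairing : Value → Value → Value
  pairing (number a)  (number b)  = entry a b
  pairing (entry a b) (entries l) = entries ((a , b) ∷ l)
  pairing _           _           = number 0

  interpret : ∀ {n} → FSym n → Vec Value n → Value
  interpret {zero} c []      = ρ c
  interpret fS (x ∷ [])      = successor x
  interpret fpr (x ∷ y ∷ []) = pairing x y
  interpret _ _              = number 0

  values : Structure
  values = record { Carrier = Value ; funI = interpret ; relI = λ _ _ → ⊤ }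

  ⟦_⟧ : Term → Value
  ⟦_⟧ = eval values

  numeral-value : ∀ {t z} → ⟦ t ⟧ ≡ number z → ∀ a → ⟦ S^ a t ⟧ ≡ number (a + z)
  numeral-value h zero    = h
  numeral-value h (suc a) = cong successor (numeral-value h a)

  numeral-value₀ : ∀ {t} → ⟦ t ⟧ ≡ number 0 → ∀ a → ⟦ S^ a t ⟧ ≡ number a
  numeral-value₀ h a = trans (numeral-value h a) (cong number (+-identityʳ a))

  table-value : ∀ {c₁ c₂ e z₁ z₂ E} → ⟦ c₁ ⟧ ≡ number z₁ → ⟦ c₂ ⟧ ≡ number z₂ → ⟦ e ⟧ ≡ entries E
              → ∀ l → ⟦ table c₁ c₂ e l ⟧ ≡ entries (map (shift z₁ z₂) l ++ E)
  table-value h₁ h₂ h []            = h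
  table-value h₁ h₂ h ((a , b) ∷ l) =
    cong₂ pairing (cong₂ pairing (numeral-value h₁ a) (numeral-value h₂ b)) (table-value h₁ h₂ h l)

  plain-table-value : ∀ {c₁ c₂ e} → ⟦ c₁ ⟧ ≡ number 0 → ⟦ c₂ ⟧ ≡ number 0 → ⟦ e ⟧ ≡ entries []
                    → ∀ l → ⟦ table c₁ c₂ e l ⟧ ≡ entries l
  plain-table-value h₁ h₂ h l =
    trans (table-value h₁ h₂ h l) (cong entries (trans (++-identityʳ _) (shift-zero l)))

-- Everything is 0 or the empty list: identifies the bases 0, 0̂, 0̃ and
-- the ends k, k̃ as the hypotheses of Sim and Sim~ demand.
uniform : FSym 0 → Value
uniform ck  = entries []
uniform c̃k = entries []
uniform _   = number 0

-- 0̂ = 1, 0̃ = m, k̃ = [(0,0)]: the hypotheses of Plus and Tim hold.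
timing : ℕ → FSym 0 → Value
timing m ĉ0 = number 1
timing m c̃0 = number m
timing m ck = entries []
timing m c̃k = entries ((0 , 0) ∷ [])
timing m _  = number 0

-- If shifting the rows of l by (1, m) and appending (0, 0) gives (p, q)
-- followed by l, then reading the equation from the end, the rows of l
-- are (n, n·m) and q ≡ p·m.
tabulates-product : ∀ m l p q → map (shift 1 m) l ++ (0 , 0) ∷ [] ≡ (p , q) ∷ l → q ≡ p * m
tabulates-product m []            p q refl = refl
tabulates-product m ((a , b) ∷ l) p q eq with ∷-injective eq
... | refl , rest = begin
  b + m           ≡⟨ cong (_+ m) (tabulates-product m l a b rest) ⟩
  a * m + m       ≡⟨ +-comm (a * m) m ⟩
  suc a * m       ≡⟨ cong (_* m) (+-comm 1 a) ⟩
  (a + 1) * m     ∎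

module Plain = Recogniser c0 c0 ck
module Tilde = Recogniser ĉ0 c̃0 c̃k

numerals-solve-Num : (a : Term) → NoUnk a → ((⊨ Num a) ⇔ Σ ℕ (λ m → a ≡ num m))
numerals-solve-Num a _ = mk⇔ to from
  where
    to : ⊨ Num a → Σ ℕ (λ m → a ≡ num m)
    to H = Plain.numeral-of-value left a (sym (H Plain.recogniser refl))

    from : Σ ℕ (λ m → a ≡ num m) → ⊨ Num a
    from (m , refl) M h = sym (Equational.S^-fixed M `0 h m)

numeral-solves-Add : ∀ m p → ⊨ Add (num m) (num p) (num (m + p)) (S^ p `0̃)
numeral-solves-Add m p M =
  (λ h → sym (S^-fixed `0̃ h p)) ,
  (λ h → S^-cong p `0 `0̃ h) ,
  (λ h → sym (trans (S^-cong p `0̃ (num m) h)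
                    (cong ⟦_⟧ (trans (S^-+ p m `0) (cong num (+-comm p m))))))
  where open Equational M

-- Sim makes the solution S^r(0̃) count p, and Plus makes it count q − m.
Add-forces-sum : ∀ m p q r → ⊨ Add (num m) (num p) (num q) (S^ r `0̃) → m + p ≡ q
Add-forces-sum m p q r H = begin
  m + p  ≡⟨ +-comm m p ⟩
  p + m  ≡⟨ cong (_+ m) p≡r ⟩
  r + m  ≡⟨ sym q≡r+m ⟩
  q      ∎
  where
    module U = Values uniform
    module V = Values (timing m)
    p≡r : p ≡ r
    p≡r = number-injective (trans (sym (U.numeral-value₀ refl p))
            (trans (proj₁ (proj₂ (H U.values)) refl) (U.numeral-value₀ refl r)))
    q≡r+m : q ≡ r + m
    q≡r+m = number-injective (trans (sym (V.numeral-value₀ refl q))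
              (trans (proj₂ (proj₂ (H V.values)) (sym (V.numeral-value₀ refl m)))
                     (V.numeral-value refl r)))

addition-solvable : (m p q : ℕ) → (Solvable₁ (λ w → Add (num m) (num p) (num q) w) ⇔ (m + p ≡ q))
addition-solvable m p q = mk⇔ to from
  where
    to : Solvable₁ (λ w → Add (num m) (num p) (num q) w) → m + p ≡ q
    to (w , _ , H) with Tilde.numeral-of-value right w (sym (proj₁ (H Tilde.recogniser) refl))
    ... | r , refl = Add-forces-sum m p q r H

    from : m + p ≡ q → Solvable₁ (λ w → Add (num m) (num p) (num q) w)
    from refl = S^ p `0̃ , noUnk-S^ p tt , numeral-solves-Add m p

plainTable tildeTable : List (ℕ × ℕ) → Term
plainTable = table `0 `0 `k
tildeTable = table `0̂ `0̃ `k̃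

products-solve-Mul : ∀ m p → ⊨ Mul (num m) (num p) (num (m * p))
                                    (plainTable (products m p)) (tildeTable (products m p))
products-solve-Mul m p M =
  (λ (h₀ , hk) → table-absorbed `0 `0 `k h₀ h₀ hk l) ,
  (λ (h₁ , h₂ , hk) → table-absorbed `0̂ `0̃ `k̃ h₁ h₂ hk l) ,
  (λ (h₁ , h₂ , hk) → table-cong `0 `0 `k `0̂ `0̃ `k̃ h₁ h₂ hk l) ,
  (λ (h₁ , h₂ , hk) → subst (λ n → ⟦ tildeTable l ⟧ ≡ ⟦ pr (pr (num p) (num n)) (plainTable l) ⟧)
                            (*-comm p m) (table-multiplication `0̂ `0̃ `k̃ `0 `k m h₁ h₂ hk p))
  where
    open Equational M
    l = products m p

-- Tab and Tab~ force both solutions to be tables, and Sim~ makes them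
-- list the same rows.
Mul-forces-tables : ∀ {x y z w w̃} → ⊨ Mul x y z w w̃
                  → Σ (List (ℕ × ℕ)) λ l → w ≡ plainTable l × w̃ ≡ tildeTable l
Mul-forces-tables {w = w} {w̃} H
  with Plain.table-of-value w (sym (proj₁ (H Plain.recogniser) (refl , refl)))
     | Tilde.table-of-value w̃ (sym (proj₁ (proj₂ (H Tilde.recogniser)) (refl , refl , refl)))
... | l , refl | l̃ , refl = l , refl , cong tildeTable (sym same-rows)
  where
    open Values uniform
    same-rows : l ≡ l̃
    same-rows = entries-injective
      (trans (sym (plain-table-value refl refl refl l))
             (trans (proj₁ (proj₂ (proj₂ (H values))) (refl , refl , refl))
                    (plain-table-value refl refl refl l̃)))

Tim-forces-product : ∀ m p q l → ⊨ Tim (num m) (num p) (num q) (plainTable l) (tildeTable l) → q ≡ p * m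
Tim-forces-product m p q l H = tabulates-product m l p q (entries-injective (begin
  entries (map (shift 1 m) l ++ (0 , 0) ∷ [])  ≡⟨ sym (table-value refl refl refl l) ⟩
  ⟦ tildeTable l ⟧                            ≡⟨ H values (refl , sym (numeral-value₀ refl m) , refl) ⟩
  ⟦ pr (pr (num p) (num q)) (plainTable l) ⟧   ≡⟨ cong₂ pairing (cong₂ pairing (numeral-value₀ refl p)
                                                                              (numeral-value₀ refl q))
                                                                (plain-table-value refl refl refl l) ⟩
  entries ((p , q) ∷ l)                       ∎))
  where open Values (timing m)

multiplication-solvable : (m p q : ℕ)
  → (Solvable₂ (λ w w₁ → Mul (num m) (num p) (num q) w w₁) ⇔ (m * p ≡ q))
multiplication-solvable m p q = mk⇔ to from
  where
    to : Solvable₂ (λ w w₁ → Mul (num m) (num p) (num q) w w₁) → m * p ≡ q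
    to (w , w̃ , _ , _ , H) with Mul-forces-tables {num m} {num p} {num q} {w} {w̃} H
    ... | l , refl , refl = trans (*-comm m p)
                                  (sym (Tim-forces-product m p q l (λ M → proj₂ (proj₂ (proj₂ (H M))))))

    from : m * p ≡ q → Solvable₂ (λ w w₁ → Mul (num m) (num p) (num q) w w₁)
    from refl = plainTable (products m p) , tildeTable (products m p) ,
                noUnk-table tt tt tt (products m p) , noUnk-table tt tt tt (products m p) ,
                products-solve-Mul m p

lemma4p2 : ((a : Term) → NoUnk a → ((⊨ Num a) ⇔ Σ ℕ (λ m → a ≡ num m)))
    × ((m p q : ℕ) → (Solvable₁ (λ w → Add (num m) (num p) (num q) w) ⇔ (m + p ≡ q)))
    × ((m p q : ℕ) → (Solvable₂ (λ w w₁ → Mul (num m) (num p) (num q) w w₁) ⇔ (m * p ≡ q)))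
lemma4p2 = numerals-solve-Num , addition-solvable , multiplication-solvable
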